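{- The set $\{M'_q: q\in Q_0^{ -1}(0)\}$ is a complete set of representatives of the right cosets $O^+_{2m}(\mathbb{F}_2)\backslash\mathrm{Sp}_{2m}(\mathbb{F}_2)$: every right coset $O^+_{2m}(\mathbb{F}_2)g$ contains exactly one $M'_q$ with $q\in Q_0^{ -1}(0)$.
   Context: $V=\mathbb{F}_2^{2m}$ (row vectors $v=(x,x^*)$, $x,x^*\in\mathbb{F}_2^m$) with symplectic form $\langle v,v'\rangle=x x'^{*T}+x^*x'^T$ and quadratic form $Q_0(v)=\sum_{i=1}^mx_ix_i^*$. $\mathrm{Sp}_{2m}(\mathbb{F}_2)$ is the group of $2m\times 2m$ matrices over $\mathbb{F}_2$ preserving $\langle\,,\rangle$ under $v\mapsto vg$, and $O^+_{2m}(\mathbb{F}_2)=\{g\in\mathrm{Sp}_{2m}(\mathbb{F}_2): Q_0(vg)=Q_0(v)\ \forall v\}$. $Q_0^{ -1}(0)=\{q\in V:Q_0(q)=0\}$. For $q=(x,x^*)$, $M'_q=1_{2m}+\begin{pmatrix}x^{*T}\\ -x^T\end{pmatrix}\begin{pmatrix}x& x^*\end{pmatrix}$ over $\mathbb{F}_2$ (the matrix of the transvection $v\mapsto v+\langle v,q\rangle q$). -}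

module Defs where

open import Data.Bool using (Bool; true; false; _xor_; _∧_; if_then_else_)
open import Data.Nat using (ℕ; _+_)
open import Data.Fin using (Fin; _↑ˡ_; _↑ʳ_; _≟_; splitAt)
open import Data.Sum using ([_,_])
open import Relation.Nullary using (does)
open import Relation.Binary.PropositionalEquality using (_≡_)
open import Data.Product using (Σ; _×_)

-- The field F₂ is modelled by Bool: addition = xor, multiplication = ∧.
F2 : Set
F2 = Bool

Σ2 : (n : ℕ) → (Fin n → F2) → F2
Σ2 ℕ.zero f = false
Σ2 (ℕ.suc n) f = f Fin.zero xor Σ2 n (λ i → f (Fin.suc i))

-- Row vectors in V = F₂^{2m}; coordinates i ↑ˡ m are x, m ↑ʳ i are x*.
V : ℕ → Set
V m = Fin (m + m) → F2

Mat : ℕ → Set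
Mat m = Fin (m + m) → Fin (m + m) → F2

xpart : (m : ℕ) → V m → Fin m → F2
xpart m v i = v (i ↑ˡ m)

xstar : (m : ℕ) → V m → Fin m → F2
xstar m v i = v (m ↑ʳ i)

vmul : (m : ℕ) → V m → Mat m → V m
vmul m v g j = Σ2 (m + m) (λ i → v i ∧ g i j)

mmul : (m : ℕ) → Mat m → Mat m → Mat m
mmul m a b i j = Σ2 (m + m) (λ k → a i k ∧ b k j)

symp : (m : ℕ) → V m → V m → F2
symp m v w = Σ2 m (λ i → xpart m v i ∧ xstar m w i)
         xor Σ2 m (λ i → xstar m v i ∧ xpart m w i)

Q0 : (m : ℕ) → V m → F2
Q0 m v = Σ2 m (λ i → xpart m v i ∧ xstar m v i)

IsSp : (m : ℕ) → Mat m → Set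
IsSp m g = (v w : V m) → symp m (vmul m v g) (vmul m w g) ≡ symp m v w

IsO+ : (m : ℕ) → Mat m → Set
IsO+ m g = IsSp m g × ((v : V m) → Q0 m (vmul m v g) ≡ Q0 m v)

one : (m : ℕ) → Mat m
one m i j = does (i ≟ j)

-- the column vector (x*ᵀ ; -xᵀ) = (x*ᵀ ; xᵀ) over F₂ (−1 = 1), indexed like V
colq : (m : ℕ) → V m → V m
colq m q k = [ (λ i → xstar m q i) , (λ i → xpart m q i) ] (splitAt m k)

-- M'_q = 1_{2m} + (x*ᵀ ; -xᵀ)(x  x*)
M' : (m : ℕ) → V m → Mat m
M' m q i j = one m i j xor (colq m q i ∧ q j)

InRightCoset : (m : ℕ) → Mat m → Mat m → Set
InRightCoset m g h = Σ (Mat m) (λ o → IsO+ m o × ((i j : Fin (m + m)) → h i j ≡ mmul m o g i j))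

MatEq : (m : ℕ) → Mat m → Mat m → Set
MatEq m a b = (i j : Fin (m + m)) → a i j ≡ b i j

-- For symplectic g the map v ↦ Q₀(vg) + Q₀(v) is linear, so Q₀(vg) = Q₀(v) + ⟨v, b⟩ for some b.
-- If Q₀(b) were 1, then Q₀((v + b)g) = Q₀(v) + 1 and v ↦ (v + b)g would be a bijection exchanging
-- the zeros and the ones of Q₀; this is impossible because Σ_v (−1)^Q₀(v) = 2^m (the Arf invariant
-- of Q₀ is 0).  Hence q₀ = bg is singular.  M'_q is the matrix of the transvection T_q, and v ↦ vg is
-- bijective (injective by nondegeneracy, V being finite), so M'_q = o g for a unique matrix o, which
-- is automatically symplectic; as Q₀(vo) = Q₀(v) + ⟨v, q⟩ + ⟨T_q v, q₀⟩, the matrix o lies in O⁺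
-- exactly when ⟨T_q v, q₀⟩ = ⟨v, q⟩ for all v.  This holds for q = q₀, and by nondegeneracy it
-- forces q = q₀.
module Submission where

open import Defs
open import Algebra.Bundles using (Monoid; CommutativeRing)
import Algebra.Properties.CommutativeMonoid.Sum as CommutativeMonoidSum
import Algebra.Properties.Semiring.Sum as SemiringSum
open import Data.Bool using (Bool; true; false; not; _xor_; _∧_)
open import Data.Bool.Properties
  using ( xor-∧-commutativeRing; xor-same; xor-identityʳ; xor-comm; xor-assoc
        ; ∧-comm; ∧-assoc; ∧-zeroʳ; ∧-identityʳ; ∧-idem; ∧-distribˡ-xor; ∧-distribʳ-xor)
open import Data.Nat using (ℕ; zero; suc; _+_; _*_; _^_)
import Data.Nat.Properties as ℕ
open import Data.Fin using (Fin; zero; suc; _↑ˡ_; _↑ʳ_; combine; finToFun; funToFin; punchOut; splitAt; join; _≟_)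
open import Data.Fin.Properties
  using ( 2↔Bool; remQuot-combine; finToFun-funToFin; funToFin-finToFin; any?; punchOut-injective
        ; <⇒notInjective; splitAt-↑ˡ; splitAt-↑ʳ; splitAt-join; join-splitAt)
open import Data.Fin.Permutation using (Permutation′; permutation)
open import Data.Vec.Functional using (Vector; _∷_; _++_)
open import Data.Vec.Functional.Properties using (++-cong; lookup-++ˡ; lookup-++ʳ)
open import Data.Integer as ℤ using (ℤ; +_; 0ℤ; 1ℤ; -1ℤ)
import Data.Integer.Properties as ℤ
open import Data.Product using (Σ; ∃; _×_; _,_; proj₁; proj₂)
open import Data.Sum using (inj₁; inj₂; [_,_])
import Data.Sum as Sum
open import Data.Sum.Properties using (swap-involutive)
open import Function using (_∘_; Inverse)
open import Function.Definitions using (Injective)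
open import Relation.Binary.Core using (_Preserves_⟶_)
open import Relation.Binary.PropositionalEquality using (_≡_; _≢_; refl; sym; trans; cong; cong₂; _≗_; module ≡-Reasoning)
open import Relation.Nullary using (does; yes; no; ¬_; contradiction)

private module 𝔽₂ = CommutativeRing xor-∧-commutativeRing
module Σ𝔽₂ = SemiringSum 𝔽₂.semiring
module Σℤ = CommutativeMonoidSum ℤ.+-0-commutativeMonoid
open import Algebra.Properties.CommutativeSemigroup 𝔽₂.+-commutativeSemigroup using (interchange)
open import Algebra.Properties.Group 𝔽₂.+-group using (∙-cancelˡ; ∙-cancelʳ)

-- Finite sums and injections of finite sets

module _ {c ℓ} (M : Monoid c ℓ) where
  open Monoid M using (Carrier; _≈_; _∙_)
  open import Algebra.Properties.Monoid.Sum M using (sum)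
  private module M = Monoid M

  sum-↑ : ∀ m {n} (f : Vector Carrier (m + n)) → sum f ≈ sum (f ∘ (_↑ˡ n)) ∙ sum (f ∘ (m ↑ʳ_))
  sum-↑ zero f = M.sym (M.identityˡ _)
  sum-↑ (suc m) f = M.trans (M.∙-congˡ (sum-↑ m (f ∘ suc))) (M.sym (M.assoc _ _ _))

  sum-combine : ∀ m {n} (f : Vector Carrier (m * n)) → sum f ≈ sum {m} (λ i → sum {n} (λ j → f (combine i j)))
  sum-combine zero f = M.refl
  sum-combine (suc m) {n} f = M.trans (sum-↑ n f) (M.∙-congˡ (sum-combine m (f ∘ (n ↑ʳ_))))

injective⇒surjective : ∀ {n} {f : Fin n → Fin n} → Injective _≡_ _≡_ f → ∀ y → ∃ λ x → f x ≡ y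
injective⇒surjective {suc n} {f} f-inj y with any? (λ x → f x ≟ y)
... | yes hit = hit
... | no miss = contradiction (λ {x} {x′} → avoid-y-injective) (<⇒notInjective (ℕ.n<1+n n))
  where
  avoid-y : Fin (suc n) → Fin n
  avoid-y x = punchOut {i = y} {j = f x} (λ y≡fx → miss (x , sym y≡fx))
  avoid-y-injective : Injective _≡_ _≡_ avoid-y
  avoid-y-injective e = f-inj (punchOut-injective {i = y} _ _ e)

injective⇒permutation : ∀ {n} {f : Fin n → Fin n} → Injective _≡_ _≡_ f → Permutation′ n
injective⇒permutation {n} {f} f-inj = permutation f f⁻¹ (λ y → proj₂ (surj y)) (λ x → f-inj (proj₂ (surj (f x))))
  where
  surj : ∀ y → ∃ λ x → f x ≡ y
  surj = injective⇒surjective f-inj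
  f⁻¹ : Fin n → Fin n
  f⁻¹ y = proj₁ (surj y)

-- Linear algebra over F₂

Σ2≡sum : ∀ n (f : Vector Bool n) → Σ2 n f ≡ Σ𝔽₂.sum f
Σ2≡sum zero f = refl
Σ2≡sum (suc n) f = cong (f zero xor_) (Σ2≡sum n (f ∘ suc))

Σ2-cong : ∀ n {f g : Vector Bool n} → f ≗ g → Σ2 n f ≡ Σ2 n g
Σ2-cong n {f} {g} f≗g = trans (Σ2≡sum n f) (trans (Σ𝔽₂.sum-cong-≗ f≗g) (sym (Σ2≡sum n g)))

Σ2-xor : ∀ n (f g : Vector Bool n) → Σ2 n (λ i → f i xor g i) ≡ Σ2 n f xor Σ2 n g
Σ2-xor n f g = trans (Σ2≡sum n _) (trans (Σ𝔽₂.∑-distrib-+ f g) (sym (cong₂ _xor_ (Σ2≡sum n f) (Σ2≡sum n g))))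

Σ2-∧ˡ : ∀ n a (f : Vector Bool n) → Σ2 n (λ i → a ∧ f i) ≡ a ∧ Σ2 n f
Σ2-∧ˡ n a f = trans (Σ2≡sum n _) (trans (sym (Σ𝔽₂.*-distribˡ-sum a f)) (cong (a ∧_) (sym (Σ2≡sum n f))))

Σ2-∧ʳ : ∀ n a (f : Vector Bool n) → Σ2 n (λ i → f i ∧ a) ≡ Σ2 n f ∧ a
Σ2-∧ʳ n a f = trans (Σ2≡sum n _) (trans (sym (Σ𝔽₂.*-distribʳ-sum a f)) (cong (_∧ a) (sym (Σ2≡sum n f))))

Σ2-comm : ∀ n k (f : Fin n → Fin k → Bool) → Σ2 n (λ i → Σ2 k (f i)) ≡ Σ2 k (λ j → Σ2 n (λ i → f i j))
Σ2-comm n k f = begin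
  Σ2 n (λ i → Σ2 k (f i))                      ≡⟨ Σ2-cong n (λ i → Σ2≡sum k (f i)) ⟩
  Σ2 n (λ i → Σ𝔽₂.sum (f i))                   ≡⟨ Σ2≡sum n _ ⟩
  Σ𝔽₂.sum (λ i → Σ𝔽₂.sum (f i))                ≡⟨ Σ𝔽₂.∑-comm f ⟩
  Σ𝔽₂.sum (λ j → Σ𝔽₂.sum (λ i → f i j))        ≡⟨ Σ2≡sum k _ ⟨
  Σ2 k (λ j → Σ𝔽₂.sum (λ i → f i j))           ≡⟨ Σ2-cong k (λ j → Σ2≡sum n (λ i → f i j)) ⟨
  Σ2 k (λ j → Σ2 n (λ i → f i j))              ∎
  where open ≡-Reasoning

Σ2-↑ : ∀ p q (f : Vector Bool (p + q)) → Σ2 (p + q) f ≡ Σ2 p (f ∘ (_↑ˡ q)) xor Σ2 q (f ∘ (p ↑ʳ_))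
Σ2-↑ p q f = trans (Σ2≡sum (p + q) f) (trans (sum-↑ 𝔽₂.+-monoid p f)
  (sym (cong₂ _xor_ (Σ2≡sum p _) (Σ2≡sum q _))))

Σ2-select : ∀ n (f : Vector Bool n) k → Σ2 n (λ l → f l ∧ does (l ≟ k)) ≡ f k
Σ2-select (suc n) f zero = begin
  (f zero ∧ true) xor Σ2 n (λ l → f (suc l) ∧ false)   ≡⟨ cong₂ _xor_ (∧-identityʳ (f zero)) (Σ2-∧ʳ n false (f ∘ suc)) ⟩
  f zero xor (Σ2 n (f ∘ suc) ∧ false)                  ≡⟨ cong (f zero xor_) (∧-zeroʳ _) ⟩
  f zero xor false                                     ≡⟨ xor-identityʳ (f zero) ⟩
  f zero                                               ∎
  where open ≡-Reasoning
Σ2-select (suc n) f (suc k) = cong₂ _xor_ (∧-zeroʳ (f zero)) (Σ2-select n (f ∘ suc) k)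

xor-interchange-cancel : ∀ a b c d s → ((a xor b) xor s) xor ((c xor d) xor s) ≡ (a xor c) xor (b xor d)
xor-interchange-cancel a b c d s = begin
  ((a xor b) xor s) xor ((c xor d) xor s)   ≡⟨ interchange (a xor b) s (c xor d) s ⟩
  ((a xor b) xor (c xor d)) xor (s xor s)   ≡⟨ cong (((a xor b) xor (c xor d)) xor_) (xor-same s) ⟩
  ((a xor b) xor (c xor d)) xor false       ≡⟨ xor-identityʳ _ ⟩
  (a xor b) xor (c xor d)                   ≡⟨ interchange a b c d ⟩
  (a xor c) xor (b xor d)                   ∎
  where open ≡-Reasoning

infixl 6 _⊕_
infixr 7 _·_

_⊕_ : ∀ {n} → Vector Bool n → Vector Bool n → Vector Bool n
(v ⊕ w) i = v i xor w i

_·_ : ∀ {n} → Bool → Vector Bool n → Vector Bool n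
(a · v) i = a ∧ v i

unit : ∀ {n} → Fin n → Vector Bool n
unit k l = does (l ≟ k)

dot : ∀ {n} → Vector Bool n → Vector Bool n → Bool
dot {n} v w = Σ2 n (λ i → v i ∧ w i)

module _ {n : ℕ} where

  dot-cong : ∀ {v v′ w w′ : Vector Bool n} → v ≗ v′ → w ≗ w′ → dot v w ≡ dot v′ w′
  dot-cong v≗v′ w≗w′ = Σ2-cong n (λ i → cong₂ _∧_ (v≗v′ i) (w≗w′ i))

  dot-comm : ∀ (v w : Vector Bool n) → dot v w ≡ dot w v
  dot-comm v w = Σ2-cong n (λ i → ∧-comm (v i) (w i))

  dot-⊕ˡ : ∀ (u v w : Vector Bool n) → dot (u ⊕ v) w ≡ dot u w xor dot v w
  dot-⊕ˡ u v w = trans (Σ2-cong n (λ i → ∧-distribʳ-xor (w i) (u i) (v i))) (Σ2-xor n _ _)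

  dot-·ˡ : ∀ a (v w : Vector Bool n) → dot (a · v) w ≡ a ∧ dot v w
  dot-·ˡ a v w = trans (Σ2-cong n (λ i → ∧-assoc a (v i) (w i))) (Σ2-∧ˡ n a _)

  dot-unitʳ : ∀ (v : Vector Bool n) k → dot v (unit k) ≡ v k
  dot-unitʳ v = Σ2-select n v

record IsLinearForm {n} (F : Vector Bool n → Bool) : Set where
  field
    cong-≗ : F Preserves _≗_ ⟶ _≡_
    ⊕-homo : ∀ v w → F (v ⊕ w) ≡ F v xor F w

  zero-homo : F (λ _ → false) ≡ false
  zero-homo = begin
    F (λ _ → false)                       ≡⟨ cong-≗ (λ _ → refl) ⟩
    F ((λ _ → false) ⊕ (λ _ → false))     ≡⟨ ⊕-homo _ _ ⟩
    F (λ _ → false) xor F (λ _ → false)   ≡⟨ xor-same (F (λ _ → false)) ⟩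
    false                                 ∎
    where open ≡-Reasoning

  ·-homo : ∀ a v → F (a · v) ≡ a ∧ F v
  ·-homo false v = trans (cong-≗ (λ _ → refl)) zero-homo
  ·-homo true  v = cong-≗ (λ _ → refl)

linearForm≡dot : ∀ {n} {F : Vector Bool n → Bool} → IsLinearForm F → ∀ w → F w ≡ dot w (F ∘ unit)
linearForm≡dot {zero} F-lin w = trans (cong-≗ (λ ())) zero-homo
  where open IsLinearForm F-lin
linearForm≡dot {suc n} {F} F-lin w = begin
  F w                                                  ≡⟨ cong-≗ w-split ⟩
  F (w zero · unit zero ⊕ (false ∷ tail))             ≡⟨ ⊕-homo _ _ ⟩
  F (w zero · unit zero) xor F (false ∷ tail)         ≡⟨ cong₂ _xor_ (·-homo (w zero) _) (linearForm≡dot G-lin tail) ⟩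
  (w zero ∧ F (unit zero)) xor dot tail (G ∘ unit)
    ≡⟨ cong ((w zero ∧ F (unit zero)) xor_) (dot-cong {v = tail} (λ _ → refl) (λ k → cong-≗ (G-unit k))) ⟩
  dot w (F ∘ unit)                                    ∎
  where
  open ≡-Reasoning
  open IsLinearForm F-lin
  tail : Vector Bool n
  tail = w ∘ suc
  G : Vector Bool n → Bool
  G u = F (false ∷ u)
  ∷-cong : ∀ {u u′ : Vector Bool n} → u ≗ u′ → (false ∷ u) ≗ (false ∷ u′)
  ∷-cong u≗u′ zero = refl
  ∷-cong u≗u′ (suc i) = u≗u′ i
  G-lin : IsLinearForm G
  G-lin = record
    { cong-≗ = cong-≗ ∘ ∷-cong
    ; ⊕-homo = λ u u′ → trans (cong-≗ (λ { zero → refl ; (suc i) → refl })) (⊕-homo _ _)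
    }
  G-unit : ∀ k → (false ∷ unit k) ≗ unit (suc k)
  G-unit k zero = refl
  G-unit k (suc l) = refl
  w-split : w ≗ w zero · unit zero ⊕ (false ∷ tail)
  w-split zero = sym (trans (xor-identityʳ _) (∧-identityʳ (w zero)))
  w-split (suc i) = cong (_xor w (suc i)) (sym (∧-zeroʳ (w zero)))

-- Summation over F₂^k

toBool : Fin 2 → Bool
toBool = Inverse.to 2↔Bool

fromBool : Bool → Fin 2
fromBool = Inverse.from 2↔Bool

decode : ∀ {k} → Fin (2 ^ k) → Vector Bool k
decode i = toBool ∘ finToFun i

encode : ∀ {k} → Vector Bool k → Fin (2 ^ k)
encode v = funToFin (fromBool ∘ v)

funToFin-cong : ∀ {k n} {f g : Fin k → Fin n} → f ≗ g → funToFin f ≡ funToFin g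
funToFin-cong {zero} f≗g = refl
funToFin-cong {suc k} f≗g = cong₂ combine (f≗g zero) (funToFin-cong (f≗g ∘ suc))

encode-cong : ∀ {k} {v w : Vector Bool k} → v ≗ w → encode v ≡ encode w
encode-cong v≗w = funToFin-cong (cong fromBool ∘ v≗w)

decode-encode : ∀ {k} (v : Vector Bool k) → decode (encode v) ≗ v
decode-encode v i = trans (cong toBool (finToFun-funToFin (fromBool ∘ v) i)) (Inverse.strictlyInverseˡ 2↔Bool (v i))

encode-decode : ∀ {k} (i : Fin (2 ^ k)) → encode (decode {k} i) ≡ i
encode-decode {k} i = trans (funToFin-cong {k} (Inverse.strictlyInverseʳ 2↔Bool ∘ finToFun {2} {k} i)) (funToFin-finToFin {k} i)

decode-combine : ∀ {k} (a : Fin 2) (j : Fin (2 ^ k)) → decode {suc k} (combine a j) ≗ toBool a ∷ decode j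
decode-combine a j zero = cong (toBool ∘ proj₁) (remQuot-combine a j)
decode-combine {k} a j (suc i) = cong (λ r → toBool (finToFun (proj₂ r) i)) (remQuot-combine {k = 2 ^ k} a j)

-- Sums over F₂^k run over Fin (2 ^ k) through finToFun; vectors are functions compared with _≗_,
-- so rewriting a summand along _≗_ needs the summand to respect _≗_.
∑ᵥ : ∀ k → (Vector Bool k → ℤ) → ℤ
∑ᵥ k F = Σℤ.sum (F ∘ decode {k})

∑ᵥ-cong : ∀ {k} {F G : Vector Bool k → ℤ} → F ≗ G → ∑ᵥ k F ≡ ∑ᵥ k G
∑ᵥ-cong F≗G = Σℤ.sum-cong-≗ (F≗G ∘ decode)

∑ᵥ-∷ : ∀ k (F : Vector Bool (suc k) → ℤ) → F Preserves _≗_ ⟶ _≡_ →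
       ∑ᵥ (suc k) F ≡ ∑ᵥ k (F ∘ (false ∷_)) ℤ.+ ∑ᵥ k (F ∘ (true ∷_))
∑ᵥ-∷ k F F-cong = begin
  ∑ᵥ (suc k) F                                           ≡⟨ sum-combine ℤ.+-0-monoid 2 {2 ^ k} (F ∘ decode) ⟩
  ∑[a] zero ℤ.+ (∑[a] (suc zero) ℤ.+ 0ℤ)                 ≡⟨ cong₂ ℤ._+_ (∑[a]≡ zero) (ℤ.+-identityʳ _) ⟩
  ∑ᵥ k (F ∘ (false ∷_)) ℤ.+ ∑[a] (suc zero)             ≡⟨ cong (ℤ._+_ (∑ᵥ k (F ∘ (false ∷_)))) (∑[a]≡ (suc zero)) ⟩
  ∑ᵥ k (F ∘ (false ∷_)) ℤ.+ ∑ᵥ k (F ∘ (true ∷_))        ∎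
  where
  open ≡-Reasoning
  ∑[a] : Fin 2 → ℤ
  ∑[a] a = Σℤ.sum (λ j → F (decode (combine {2} {2 ^ k} a j)))
  ∑[a]≡ : ∀ a → ∑[a] a ≡ ∑ᵥ k (F ∘ (toBool a ∷_))
  ∑[a]≡ a = Σℤ.sum-cong-≗ (λ j → F-cong (decode-combine a j))

∷-++ : ∀ {p q} (a : Bool) (x : Vector Bool p) (y : Vector Bool q) → (a ∷ x) ++ y ≗ a ∷ (x ++ y)
∷-++ {p} a x y zero = refl
∷-++ {p} a x y (suc i) with splitAt p i
... | inj₁ _ = refl
... | inj₂ _ = refl

∑ᵥ-++ : ∀ p {q} {F : Vector Bool (p + q) → ℤ} → F Preserves _≗_ ⟶ _≡_ →
        ∑ᵥ (p + q) F ≡ ∑ᵥ p (λ x → ∑ᵥ q (λ y → F (x ++ y)))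
∑ᵥ-++ zero F-cong = sym (ℤ.+-identityʳ _)
∑ᵥ-++ (suc p) {q} {F} F-cong = begin
  ∑ᵥ (suc p + q) F                                                   ≡⟨ ∑ᵥ-∷ (p + q) F F-cong ⟩
  ∑ᵥ (p + q) (F ∘ (false ∷_)) ℤ.+ ∑ᵥ (p + q) (F ∘ (true ∷_))         ≡⟨ cong₂ ℤ._+_ (split false) (split true) ⟩
  ∑ᵥ p (inner ∘ (false ∷_)) ℤ.+ ∑ᵥ p (inner ∘ (true ∷_))             ≡⟨ sym (∑ᵥ-∷ p inner inner-cong) ⟩
  ∑ᵥ (suc p) inner                                                   ∎
  where
  open ≡-Reasoning
  inner : Vector Bool (suc p) → ℤ
  inner x = ∑ᵥ q (λ y → F (x ++ y))
  inner-cong : inner Preserves _≗_ ⟶ _≡_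
  inner-cong {x} {x′} x≗x′ = ∑ᵥ-cong {q} (λ y → F-cong (++-cong {ys = y} x x′ x≗x′ (λ _ → refl)))
  split : ∀ a → ∑ᵥ (p + q) (F ∘ (a ∷_)) ≡ ∑ᵥ p (inner ∘ (a ∷_))
  split a = trans (∑ᵥ-++ p {q} (F-cong ∘ cong-∷)) (∑ᵥ-cong {p} (λ x → ∑ᵥ-cong {q} (λ y → F-cong (sym ∘ ∷-++ a x y))))
    where
    cong-∷ : ∀ {v w : Vector Bool (p + q)} → v ≗ w → (a ∷ v) ≗ (a ∷ w)
    cong-∷ v≗w zero = refl
    cong-∷ v≗w (suc i) = v≗w i

module _ {k} {ψ : Vector Bool k → Vector Bool k} (ψ-inj : Injective _≗_ _≗_ ψ) where
  private
    ψ̂ : Fin (2 ^ k) → Fin (2 ^ k)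
    ψ̂ = encode ∘ ψ ∘ decode

    decode-ψ̂ : ∀ i → decode (ψ̂ i) ≗ ψ (decode i)
    decode-ψ̂ i = decode-encode (ψ (decode i))

    ψ̂-injective : Injective _≡_ _≡_ ψ̂
    ψ̂-injective {i} {j} ψ̂i≡ψ̂j = begin
      i                     ≡⟨ encode-decode {k} i ⟨
      encode (decode {k} i)
        ≡⟨ encode-cong (ψ-inj λ l → trans (sym (decode-ψ̂ i l)) (trans (cong (λ z → decode z l) ψ̂i≡ψ̂j) (decode-ψ̂ j l))) ⟩
      encode (decode {k} j) ≡⟨ encode-decode {k} j ⟩
      j                     ∎
      where open ≡-Reasoning

  injective⇒surjectiveᵥ : ∀ w → ∃ λ v → ψ v ≗ w
  injective⇒surjectiveᵥ w with i , ψ̂i≡w ← injective⇒surjective ψ̂-injective (encode w) =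
    decode i , λ l → trans (sym (decode-ψ̂ i l)) (trans (cong (λ z → decode z l) ψ̂i≡w) (decode-encode w l))

  ∑ᵥ-reindex : ∀ {F : Vector Bool k → ℤ} → F Preserves _≗_ ⟶ _≡_ → ∑ᵥ k (F ∘ ψ) ≡ ∑ᵥ k F
  ∑ᵥ-reindex {F} F-cong = sym (trans (Σℤ.sum-permute (F ∘ decode) (injective⇒permutation ψ̂-injective))
                                      (Σℤ.sum-cong-≗ (λ i → F-cong (decode-ψ̂ i))))

-- The character sum of Q₀

χ : Bool → ℤ
χ false = 1ℤ
χ true  = -1ℤ

∑ᵥ-χ-complement : ∀ k (F : Vector Bool k → Bool) → ∑ᵥ k (χ ∘ F) ℤ.+ ∑ᵥ k (χ ∘ not ∘ F) ≡ 0ℤ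
∑ᵥ-χ-complement k F = begin
  ∑ᵥ k (χ ∘ F) ℤ.+ ∑ᵥ k (χ ∘ not ∘ F)          ≡⟨ Σℤ.∑-distrib-+ (χ ∘ F ∘ decode) (χ ∘ not ∘ F ∘ decode) ⟨
  ∑ᵥ k (λ v → χ (F v) ℤ.+ χ (not (F v)))       ≡⟨ ∑ᵥ-cong (χ-cancel ∘ F) ⟩
  ∑ᵥ k (λ _ → 0ℤ)                              ≡⟨ Σℤ.sum-replicate-zero (2 ^ k) ⟩
  0ℤ                                           ∎
  where
  open ≡-Reasoning
  χ-cancel : ∀ b → χ b ℤ.+ χ (not b) ≡ 0ℤ
  χ-cancel false = refl
  χ-cancel true  = refl

-- Splitting off the first coordinates a and c of x and y: Σ_c (−1)^(ac) is 2 if a = 0 and 0 if a = 1.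
∑ᵥ∑ᵥ-χ-dot : ∀ m → ∑ᵥ m (λ x → ∑ᵥ m (λ y → χ (dot x y))) ≡ + 2 ^ m
∑ᵥ∑ᵥ-χ-dot zero = refl
∑ᵥ∑ᵥ-χ-dot (suc m) = begin
  ∑ᵥ (suc m) J                                         ≡⟨ ∑ᵥ-∷ m J J-cong ⟩
  ∑ᵥ m (J ∘ (false ∷_)) ℤ.+ ∑ᵥ m (J ∘ (true ∷_))       ≡⟨ cong₂ ℤ._+_ (∑ᵥ-cong J-false) (∑ᵥ-cong J-true) ⟩
  ∑ᵥ m (λ x → I x ℤ.+ I x) ℤ.+ ∑ᵥ m (λ _ → 0ℤ)
    ≡⟨ cong₂ ℤ._+_ (Σℤ.∑-distrib-+ (I ∘ decode) (I ∘ decode)) (Σℤ.sum-replicate-zero (2 ^ m)) ⟩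
  (∑ᵥ m I ℤ.+ ∑ᵥ m I) ℤ.+ 0ℤ                            ≡⟨ cong (λ s → (s ℤ.+ s) ℤ.+ 0ℤ) (∑ᵥ∑ᵥ-χ-dot m) ⟩
  + (2 ^ m + 2 ^ m + 0)                                 ≡⟨ cong +_ (ℕ.+-assoc (2 ^ m) (2 ^ m) 0) ⟩
  + 2 ^ suc m                                           ∎
  where
  open ≡-Reasoning
  I : Vector Bool m → ℤ
  I x = ∑ᵥ m (λ y → χ (dot x y))
  J : Vector Bool (suc m) → ℤ
  J x = ∑ᵥ (suc m) (λ y → χ (dot x y))
  J-cong : J Preserves _≗_ ⟶ _≡_
  J-cong x≗x′ = ∑ᵥ-cong {suc m} (λ y → cong χ (dot-cong {w = y} x≗x′ (λ _ → refl)))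
  J-split : ∀ x → J x ≡ ∑ᵥ m (λ y → χ (dot x (false ∷ y))) ℤ.+ ∑ᵥ m (λ y → χ (dot x (true ∷ y)))
  J-split x = ∑ᵥ-∷ m (λ y → χ (dot x y)) (λ y≗y′ → cong χ (dot-cong {v = x} (λ _ → refl) y≗y′))
  J-false : ∀ x → J (false ∷ x) ≡ I x ℤ.+ I x
  J-false x = J-split (false ∷ x)
  J-true : ∀ x → J (true ∷ x) ≡ 0ℤ
  J-true x = trans (J-split (true ∷ x)) (∑ᵥ-χ-complement m (dot x))

Q0-cong : ∀ m → Q0 m Preserves _≗_ ⟶ _≡_
Q0-cong m v≗w = dot-cong (v≗w ∘ (_↑ˡ m)) (v≗w ∘ (m ↑ʳ_))

Q0-++ : ∀ m (x y : Vector Bool m) → Q0 m (x ++ y) ≡ dot x y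
Q0-++ m x y = Σ2-cong m (λ i → cong₂ _∧_ (lookup-++ˡ x y i) (lookup-++ʳ x y i))

∑ᵥ-χ-Q0 : ∀ m → ∑ᵥ (m + m) (χ ∘ Q0 m) ≡ + 2 ^ m
∑ᵥ-χ-Q0 m = begin
  ∑ᵥ (m + m) (χ ∘ Q0 m)                                 ≡⟨ ∑ᵥ-++ m (cong χ ∘ Q0-cong m) ⟩
  ∑ᵥ m (λ x → ∑ᵥ m (λ y → χ (Q0 m (x ++ y))))           ≡⟨ ∑ᵥ-cong (λ x → ∑ᵥ-cong (cong χ ∘ Q0-++ m x)) ⟩
  ∑ᵥ m (λ x → ∑ᵥ m (λ y → χ (dot x y)))                 ≡⟨ ∑ᵥ∑ᵥ-χ-dot m ⟩
  + 2 ^ m                                               ∎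
  where open ≡-Reasoning

Q0-not-complementable : ∀ m {ψ : V m → V m} → Injective _≗_ _≗_ ψ →
                        ¬ (∀ v → Q0 m (ψ v) ≡ not (Q0 m v))
Q0-not-complementable m {ψ} ψ-inj ψ-complements =
  2≢0 (ℕ.m^n≡0⇒m≡0 2 m (ℕ.m+n≡0⇒m≡0 (2 ^ m) (ℤ.+-injective 2^m+2^m≡0)))
  where
  open ≡-Reasoning
  χQ0-cong : (χ ∘ Q0 m) Preserves _≗_ ⟶ _≡_
  χQ0-cong = cong χ ∘ Q0-cong m
  2^m+2^m≡0 : + 2 ^ m ℤ.+ + 2 ^ m ≡ 0ℤ
  2^m+2^m≡0 = begin
    + 2 ^ m ℤ.+ + 2 ^ m                                   ≡⟨ cong₂ ℤ._+_ (∑ᵥ-χ-Q0 m) (trans (∑ᵥ-reindex ψ-inj χQ0-cong) (∑ᵥ-χ-Q0 m)) ⟨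
    ∑ᵥ (m + m) (χ ∘ Q0 m) ℤ.+ ∑ᵥ (m + m) (χ ∘ Q0 m ∘ ψ)    ≡⟨ cong (ℤ._+_ (∑ᵥ (m + m) (χ ∘ Q0 m))) (∑ᵥ-cong (cong χ ∘ ψ-complements)) ⟩
    ∑ᵥ (m + m) (χ ∘ Q0 m) ℤ.+ ∑ᵥ (m + m) (χ ∘ not ∘ Q0 m) ≡⟨ ∑ᵥ-χ-complement (m + m) (Q0 m) ⟩
    0ℤ                                                    ∎
  2≢0 : 2 ≢ 0
  2≢0 ()

-- The symplectic form and transvections

module _ (m : ℕ) where

  symp-cong : ∀ {v v′ w w′ : V m} → v ≗ v′ → w ≗ w′ → symp m v w ≡ symp m v′ w′
  symp-cong v≗v′ w≗w′ = cong₂ _xor_ (dot-cong (v≗v′ ∘ (_↑ˡ m)) (w≗w′ ∘ (m ↑ʳ_)))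
                                    (dot-cong (v≗v′ ∘ (m ↑ʳ_)) (w≗w′ ∘ (_↑ˡ m)))

  symp-comm : ∀ v w → symp m v w ≡ symp m w v
  symp-comm v w = trans (cong₂ _xor_ (dot-comm (xpart m v) (xstar m w)) (dot-comm (xstar m v) (xpart m w)))
                        (xor-comm (dot (xstar m w) (xpart m v)) (dot (xpart m w) (xstar m v)))

  symp-self : ∀ v → symp m v v ≡ false
  symp-self v = trans (cong (dot (xpart m v) (xstar m v) xor_) (dot-comm (xstar m v) (xpart m v)))
                      (xor-same (dot (xpart m v) (xstar m v)))

  symp-⊕ˡ : ∀ u v w → symp m (u ⊕ v) w ≡ symp m u w xor symp m v w
  symp-⊕ˡ u v w = trans (cong₂ _xor_ (dot-⊕ˡ (xpart m u) (xpart m v) (xstar m w)) (dot-⊕ˡ (xstar m u) (xstar m v) (xpart m w)))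
                        (interchange (dot (xpart m u) (xstar m w)) (dot (xpart m v) (xstar m w))
                                     (dot (xstar m u) (xpart m w)) (dot (xstar m v) (xpart m w)))

  symp-·ˡ : ∀ a v w → symp m (a · v) w ≡ a ∧ symp m v w
  symp-·ˡ a v w = trans (cong₂ _xor_ (dot-·ˡ a (xpart m v) (xstar m w)) (dot-·ˡ a (xstar m v) (xpart m w)))
                        (sym (∧-distribˡ-xor a (dot (xpart m v) (xstar m w)) (dot (xstar m v) (xpart m w))))

  symp-·ʳ : ∀ a u v → symp m u (a · v) ≡ a ∧ symp m u v
  symp-·ʳ a u v = trans (symp-comm u (a · v)) (trans (symp-·ˡ a v u) (cong (a ∧_) (symp-comm v u)))

  Q0-⊕ : ∀ v w → Q0 m (v ⊕ w) ≡ (Q0 m v xor Q0 m w) xor symp m v w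
  Q0-⊕ v w = trans (Σ2-cong m (λ i → expand (v (i ↑ˡ m)) (w (i ↑ˡ m)) (v (m ↑ʳ i)) (w (m ↑ʳ i))))
                   (trans (Σ2-xor m _ _) (cong₂ _xor_ (Σ2-xor m _ _) (Σ2-xor m _ _)))
    where
    expand : ∀ a b c d → (a xor b) ∧ (c xor d) ≡ ((a ∧ c) xor (b ∧ d)) xor ((a ∧ d) xor (c ∧ b))
    expand a b c d = begin
      (a xor b) ∧ (c xor d)                           ≡⟨ ∧-distribˡ-xor (a xor b) c d ⟩
      ((a xor b) ∧ c) xor ((a xor b) ∧ d)             ≡⟨ cong₂ _xor_ (∧-distribʳ-xor c a b) (∧-distribʳ-xor d a b) ⟩
      ((a ∧ c) xor (b ∧ c)) xor ((a ∧ d) xor (b ∧ d)) ≡⟨ cong (((a ∧ c) xor (b ∧ c)) xor_) (xor-comm (a ∧ d) (b ∧ d)) ⟩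
      ((a ∧ c) xor (b ∧ c)) xor ((b ∧ d) xor (a ∧ d)) ≡⟨ interchange (a ∧ c) (b ∧ c) (b ∧ d) (a ∧ d) ⟩
      ((a ∧ c) xor (b ∧ d)) xor ((b ∧ c) xor (a ∧ d))
        ≡⟨ cong (((a ∧ c) xor (b ∧ d)) xor_) (trans (xor-comm (b ∧ c) (a ∧ d)) (cong ((a ∧ d) xor_) (∧-comm b c))) ⟩
      ((a ∧ c) xor (b ∧ d)) xor ((a ∧ d) xor (c ∧ b)) ∎
      where open ≡-Reasoning

  Q0-· : ∀ a v → Q0 m (a · v) ≡ a ∧ Q0 m v
  Q0-· false v = Σ2-∧ˡ m false (xstar m v)
  Q0-· true  v = refl

  swapHalves : Fin (m + m) → Fin (m + m)
  swapHalves = join m m ∘ Sum.swap ∘ splitAt m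

  swapHalves-involutive : ∀ k → swapHalves (swapHalves k) ≡ k
  swapHalves-involutive k = begin
    join m m (Sum.swap (splitAt m (join m m (Sum.swap (splitAt m k)))))
      ≡⟨ cong (join m m ∘ Sum.swap) (splitAt-join m m (Sum.swap (splitAt m k))) ⟩
    join m m (Sum.swap (Sum.swap (splitAt m k)))                         ≡⟨ cong (join m m) (swap-involutive (splitAt m k)) ⟩
    join m m (splitAt m k)                                               ≡⟨ join-splitAt m m k ⟩
    k                                                                    ∎
    where open ≡-Reasoning

  colq≗∘swapHalves : ∀ w → colq m w ≗ w ∘ swapHalves
  colq≗∘swapHalves w k with splitAt m k
  ... | inj₁ i = refl
  ... | inj₂ i = refl

  symp≡dot-colq : ∀ v w → symp m v w ≡ dot v (colq m w)
  symp≡dot-colq v w = sym (trans (Σ2-↑ m m _) (cong₂ _xor_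
    (Σ2-cong m (λ i → cong (λ s → v (i ↑ˡ m) ∧ [ xstar m w , xpart m w ] s) (splitAt-↑ˡ m i m)))
    (Σ2-cong m (λ i → cong (λ s → v (m ↑ʳ i) ∧ [ xstar m w , xpart m w ] s) (splitAt-↑ʳ m m i)))))

  symp-unit-swapHalves : ∀ k w → symp m (unit (swapHalves k)) w ≡ w k
  symp-unit-swapHalves k w = begin
    symp m (unit (swapHalves k)) w               ≡⟨ symp≡dot-colq (unit (swapHalves k)) w ⟩
    dot (unit (swapHalves k)) (colq m w)         ≡⟨ dot-comm (unit (swapHalves k)) (colq m w) ⟩
    dot (colq m w) (unit (swapHalves k))         ≡⟨ dot-unitʳ (colq m w) (swapHalves k) ⟩
    colq m w (swapHalves k)                      ≡⟨ colq≗∘swapHalves w (swapHalves k) ⟩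
    w (swapHalves (swapHalves k))                ≡⟨ cong w (swapHalves-involutive k) ⟩
    w k                                          ∎
    where open ≡-Reasoning

  symp-nondegenerate : ∀ {w w′} → (∀ u → symp m u w ≡ symp m u w′) → w ≗ w′
  symp-nondegenerate {w} {w′} same k =
    trans (sym (symp-unit-swapHalves k w)) (trans (same (unit (swapHalves k))) (symp-unit-swapHalves k w′))

  linearForm≡symp : ∀ {F : V m → Bool} → IsLinearForm F → ∃ λ b → ∀ w → F w ≡ symp m w b
  linearForm≡symp {F} F-lin = b , λ w → begin
    F w                   ≡⟨ linearForm≡dot F-lin w ⟩
    dot w (F ∘ unit)      ≡⟨ dot-cong {v = w} (λ _ → refl) colq-b ⟨
    dot w (colq m b)      ≡⟨ symp≡dot-colq w b ⟨
    symp m w b            ∎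
    where
    open ≡-Reasoning
    b : V m
    b = F ∘ unit ∘ swapHalves
    colq-b : colq m b ≗ F ∘ unit
    colq-b k = trans (colq≗∘swapHalves b k) (cong (F ∘ unit) (swapHalves-involutive k))

  transvection : V m → V m → V m
  transvection q v = v ⊕ symp m v q · q

  symp-transvectionˡ : ∀ q v u → symp m (transvection q v) u ≡ symp m v u xor (symp m v q ∧ symp m q u)
  symp-transvectionˡ q v u = trans (symp-⊕ˡ v (symp m v q · q) u) (cong (symp m v u xor_) (symp-·ˡ (symp m v q) q u))

  symp-transvection-center : ∀ q v → symp m (transvection q v) q ≡ symp m v q
  symp-transvection-center q v = begin
    symp m (transvection q v) q               ≡⟨ symp-transvectionˡ q v q ⟩
    symp m v q xor (symp m v q ∧ symp m q q)  ≡⟨ cong (λ x → symp m v q xor (symp m v q ∧ x)) (symp-self q) ⟩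
    symp m v q xor (symp m v q ∧ false)       ≡⟨ cong (symp m v q xor_) (∧-zeroʳ (symp m v q)) ⟩
    symp m v q xor false                      ≡⟨ xor-identityʳ (symp m v q) ⟩
    symp m v q                                ∎
    where open ≡-Reasoning

  symp-transvection : ∀ q v w → symp m (transvection q v) (transvection q w) ≡ symp m v w
  symp-transvection q v w = begin
    symp m (T v) (T w)                              ≡⟨ symp-transvectionˡ q v (T w) ⟩
    symp m v (T w) xor (a ∧ symp m q (T w))         ≡⟨ cong₂ (λ x y → x xor (a ∧ y)) v·Tw q·Tw ⟩
    (symp m v w xor (c ∧ a)) xor (a ∧ c)            ≡⟨ xor-assoc (symp m v w) (c ∧ a) (a ∧ c) ⟩
    symp m v w xor ((c ∧ a) xor (a ∧ c))            ≡⟨ cong (λ x → symp m v w xor (x xor (a ∧ c))) (∧-comm c a) ⟩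
    symp m v w xor ((a ∧ c) xor (a ∧ c))            ≡⟨ cong (symp m v w xor_) (xor-same (a ∧ c)) ⟩
    symp m v w xor false                            ≡⟨ xor-identityʳ (symp m v w) ⟩
    symp m v w                                      ∎
    where
    open ≡-Reasoning
    T = transvection q
    a = symp m v q
    c = symp m w q
    v·Tw : symp m v (T w) ≡ symp m v w xor (c ∧ a)
    v·Tw = trans (symp-comm v (T w)) (trans (symp-transvectionˡ q w v)
             (cong₂ (λ x y → x xor (c ∧ y)) (symp-comm w v) (symp-comm q v)))
    q·Tw : symp m q (T w) ≡ c
    q·Tw = trans (symp-comm q (T w)) (symp-transvection-center q w)

  Q0-transvection : ∀ q → Q0 m q ≡ false → ∀ v → Q0 m (transvection q v) ≡ Q0 m v xor symp m v q
  Q0-transvection q q-singular v = begin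
    Q0 m (v ⊕ a · q)                                ≡⟨ Q0-⊕ v (a · q) ⟩
    (Q0 m v xor Q0 m (a · q)) xor symp m v (a · q)
      ≡⟨ cong₂ (λ x y → (Q0 m v xor x) xor y) (trans (Q0-· a q) (cong (a ∧_) q-singular)) (symp-·ʳ a v q) ⟩
    (Q0 m v xor (a ∧ false)) xor (a ∧ a)            ≡⟨ cong₂ (λ x y → (Q0 m v xor x) xor y) (∧-zeroʳ a) (∧-idem a) ⟩
    (Q0 m v xor false) xor a                        ≡⟨ cong (_xor a) (xor-identityʳ (Q0 m v)) ⟩
    Q0 m v xor a                                    ∎
    where
    open ≡-Reasoning
    a = symp m v q

  transvection-center-unique : ∀ {q q₀} → (∀ v → symp m (transvection q v) q₀ ≡ symp m v q) → q ≗ q₀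
  transvection-center-unique {q} {q₀} same with symp m q q₀ in q·q₀
  ... | false = symp-nondegenerate λ v → begin
    symp m v q                                      ≡⟨ same v ⟨
    symp m (transvection q v) q₀                    ≡⟨ symp-transvectionˡ q v q₀ ⟩
    symp m v q₀ xor (symp m v q ∧ symp m q q₀)      ≡⟨ cong (λ x → symp m v q₀ xor (symp m v q ∧ x)) q·q₀ ⟩
    symp m v q₀ xor (symp m v q ∧ false)            ≡⟨ cong (symp m v q₀ xor_) (∧-zeroʳ (symp m v q)) ⟩
    symp m v q₀ xor false                           ≡⟨ xor-identityʳ (symp m v q₀) ⟩
    symp m v q₀                                     ∎
    where open ≡-Reasoning
  ... | true = contradiction (begin
    true                                            ≡⟨ q·q₀ ⟨
    symp m q q₀                                     ≡⟨ xor-identityʳ (symp m q q₀) ⟨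
    symp m q q₀ xor false                           ≡⟨ cong (λ x → symp m q q₀ xor (x ∧ symp m q q₀)) (symp-self q) ⟨
    symp m q q₀ xor (symp m q q ∧ symp m q q₀)      ≡⟨ symp-transvectionˡ q q q₀ ⟨
    symp m (transvection q q) q₀                    ≡⟨ same q ⟩
    symp m q q                                      ≡⟨ symp-self q ⟩
    false                                           ∎) (λ ())
    where open ≡-Reasoning

  M'-cong : ∀ {q q′ : V m} → q ≗ q′ → MatEq m (M' m q) (M' m q′)
  M'-cong {q} {q′} q≗q′ i j = cong₂ (λ x y → one m i j xor (x ∧ y)) colq-i (q≗q′ j)
    where
    colq-i : colq m q i ≡ colq m q′ i
    colq-i = trans (colq≗∘swapHalves q i) (trans (q≗q′ (swapHalves i)) (sym (colq≗∘swapHalves q′ i)))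

  vmul-M' : ∀ q v → vmul m v (M' m q) ≗ transvection q v
  vmul-M' q v j = begin
    Σ2 (m + m) (λ i → v i ∧ (one m i j xor (colq m q i ∧ q j)))                 ≡⟨ Σ2-cong (m + m) (λ i → ∧-distribˡ-xor (v i) _ _) ⟩
    Σ2 (m + m) (λ i → (v i ∧ one m i j) xor (v i ∧ (colq m q i ∧ q j)))          ≡⟨ Σ2-xor (m + m) _ _ ⟩
    Σ2 (m + m) (λ i → v i ∧ one m i j) xor Σ2 (m + m) (λ i → v i ∧ (colq m q i ∧ q j))
      ≡⟨ cong₂ _xor_ (dot-unitʳ v j) (trans (Σ2-cong (m + m) (λ i → sym (∧-assoc (v i) _ _))) (Σ2-∧ʳ (m + m) (q j) _)) ⟩
    v j xor (dot v (colq m q) ∧ q j)                                              ≡⟨ cong (λ x → v j xor (x ∧ q j)) (symp≡dot-colq v q) ⟨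
    v j xor (symp m v q ∧ q j)                                                    ∎
    where open ≡-Reasoning

  vmul-cong : ∀ (g : Mat m) {v w} → v ≗ w → vmul m v g ≗ vmul m w g
  vmul-cong g v≗w j = Σ2-cong (m + m) (λ i → cong (_∧ g i j) (v≗w i))

  vmul-cong-Mat : ∀ v {a b : Mat m} → MatEq m a b → vmul m v a ≗ vmul m v b
  vmul-cong-Mat v a≡b j = Σ2-cong (m + m) (λ i → cong (v i ∧_) (a≡b i j))

  vmul-⊕ : ∀ (g : Mat m) v w → vmul m (v ⊕ w) g ≗ vmul m v g ⊕ vmul m w g
  vmul-⊕ g v w j = trans (Σ2-cong (m + m) (λ i → ∧-distribʳ-xor (g i j) (v i) (w i))) (Σ2-xor (m + m) _ _)

  vmul-mmul : ∀ v (a b : Mat m) → vmul m v (mmul m a b) ≗ vmul m (vmul m v a) b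
  vmul-mmul v a b j = begin
    Σ2 (m + m) (λ i → v i ∧ Σ2 (m + m) (λ k → a i k ∧ b k j))     ≡⟨ Σ2-cong (m + m) (λ i → Σ2-∧ˡ (m + m) (v i) _) ⟨
    Σ2 (m + m) (λ i → Σ2 (m + m) (λ k → v i ∧ (a i k ∧ b k j)))   ≡⟨ Σ2-comm (m + m) (m + m) _ ⟩
    Σ2 (m + m) (λ k → Σ2 (m + m) (λ i → v i ∧ (a i k ∧ b k j)))
      ≡⟨ Σ2-cong (m + m) (λ k → Σ2-cong (m + m) (λ i → ∧-assoc (v i) (a i k) (b k j))) ⟨
    Σ2 (m + m) (λ k → Σ2 (m + m) (λ i → (v i ∧ a i k) ∧ b k j))   ≡⟨ Σ2-cong (m + m) (λ k → Σ2-∧ʳ (m + m) (b k j) _) ⟩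
    Σ2 (m + m) (λ k → vmul m v a k ∧ b k j)                       ∎
    where open ≡-Reasoning

-- Symplectic matrices and the cosets of O⁺

module SymplecticMatrix (m : ℕ) (g : Mat m) (g-sp : IsSp m g) where

  act : V m → V m
  act v = vmul m v g

  act-injective : Injective _≗_ _≗_ act
  act-injective {v} {w} gv≗gw = symp-nondegenerate m λ u → begin
    symp m u v                   ≡⟨ g-sp u v ⟨
    symp m (act u) (act v)       ≡⟨ symp-cong m {v = act u} (λ _ → refl) gv≗gw ⟩
    symp m (act u) (act w)       ≡⟨ g-sp u w ⟩
    symp m u w                   ∎
    where open ≡-Reasoning

  act-surjective : ∀ w → ∃ λ v → act v ≗ w
  act-surjective = injective⇒surjectiveᵥ act-injective

  defect : V m → Bool
  defect w = Q0 m w xor Q0 m (act w)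

  defect-linear : IsLinearForm defect
  defect-linear = record
    { cong-≗ = λ v≗w → cong₂ _xor_ (Q0-cong m v≗w) (Q0-cong m (vmul-cong m g v≗w))
    ; ⊕-homo = λ v w → begin
        Q0 m (v ⊕ w) xor Q0 m (act (v ⊕ w))
          ≡⟨ cong₂ _xor_ (Q0-⊕ m v w) (trans (Q0-cong m (vmul-⊕ m g v w)) (Q0-⊕ m (act v) (act w))) ⟩
        ((Q0 m v xor Q0 m w) xor symp m v w) xor ((Q0 m (act v) xor Q0 m (act w)) xor symp m (act v) (act w))
          ≡⟨ cong (λ s → ((Q0 m v xor Q0 m w) xor symp m v w) xor ((Q0 m (act v) xor Q0 m (act w)) xor s)) (g-sp v w) ⟩
        ((Q0 m v xor Q0 m w) xor symp m v w) xor ((Q0 m (act v) xor Q0 m (act w)) xor symp m v w)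
          ≡⟨ xor-interchange-cancel (Q0 m v) (Q0 m w) (Q0 m (act v)) (Q0 m (act w)) (symp m v w) ⟩
        defect v xor defect w   ∎
    }
    where open ≡-Reasoning

  b : V m
  b = proj₁ (linearForm≡symp m defect-linear)

  Q0-act : ∀ w → Q0 m (act w) ≡ Q0 m w xor symp m w b
  Q0-act w = begin
    Q0 m (act w)                              ≡⟨ cong (_xor Q0 m (act w)) (xor-same (Q0 m w)) ⟨
    (Q0 m w xor Q0 m w) xor Q0 m (act w)      ≡⟨ xor-assoc (Q0 m w) (Q0 m w) (Q0 m (act w)) ⟩
    Q0 m w xor defect w                       ≡⟨ cong (Q0 m w xor_) (proj₂ (linearForm≡symp m defect-linear) w) ⟩
    Q0 m w xor symp m w b                     ∎
    where open ≡-Reasoning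

  Q0-act-translate : ∀ v → Q0 m (act (v ⊕ b)) ≡ Q0 m v xor Q0 m b
  Q0-act-translate v = begin
    Q0 m (act (v ⊕ b))                                          ≡⟨ Q0-act (v ⊕ b) ⟩
    Q0 m (v ⊕ b) xor symp m (v ⊕ b) b                           ≡⟨ cong₂ _xor_ (Q0-⊕ m v b) (symp-⊕ˡ m v b b) ⟩
    ((Q0 m v xor Q0 m b) xor s) xor (s xor symp m b b)          ≡⟨ cong (λ x → ((Q0 m v xor Q0 m b) xor s) xor (s xor x)) (symp-self m b) ⟩
    ((Q0 m v xor Q0 m b) xor s) xor (s xor false)               ≡⟨ cong (((Q0 m v xor Q0 m b) xor s) xor_) (xor-identityʳ s) ⟩
    ((Q0 m v xor Q0 m b) xor s) xor s                           ≡⟨ xor-assoc (Q0 m v xor Q0 m b) s s ⟩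
    (Q0 m v xor Q0 m b) xor (s xor s)                           ≡⟨ cong ((Q0 m v xor Q0 m b) xor_) (xor-same s) ⟩
    (Q0 m v xor Q0 m b) xor false                               ≡⟨ xor-identityʳ (Q0 m v xor Q0 m b) ⟩
    Q0 m v xor Q0 m b                                           ∎
    where
    open ≡-Reasoning
    s = symp m v b

  Q0-b : Q0 m b ≡ false
  Q0-b with Q0 m b in Q0b≡
  ... | false = refl
  ... | true = contradiction complements (Q0-not-complementable m ψ-injective)
    where
    ψ : V m → V m
    ψ v = act (v ⊕ b)
    ψ-injective : Injective _≗_ _≗_ ψ
    ψ-injective {v} {w} ψv≗ψw i = ∙-cancelʳ (b i) (v i) (w i) (act-injective ψv≗ψw i)
    complements : ∀ v → Q0 m (ψ v) ≡ not (Q0 m v)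
    complements v = trans (Q0-act-translate v) (trans (cong (Q0 m v xor_) Q0b≡) (xor-comm (Q0 m v) true))

  q₀ : V m
  q₀ = act b

  Q0-q₀ : Q0 m q₀ ≡ false
  Q0-q₀ = trans (Q0-act b) (cong₂ _xor_ Q0-b (symp-self m b))

  module InCoset {o : Mat m} {q : V m} (M'q≡o·g : MatEq m (M' m q) (mmul m o g)) where

    act-vo : ∀ v → act (vmul m v o) ≗ transvection m q v
    act-vo v j = begin
      vmul m (vmul m v o) g j      ≡⟨ vmul-mmul m v o g j ⟨
      vmul m v (mmul m o g) j      ≡⟨ vmul-cong-Mat m v M'q≡o·g j ⟨
      vmul m v (M' m q) j          ≡⟨ vmul-M' m q v j ⟩
      transvection m q v j         ∎
      where open ≡-Reasoning

    o-symplectic : IsSp m o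
    o-symplectic v w = begin
      symp m (vmul m v o) (vmul m w o)               ≡⟨ g-sp (vmul m v o) (vmul m w o) ⟨
      symp m (act (vmul m v o)) (act (vmul m w o))   ≡⟨ symp-cong m (act-vo v) (act-vo w) ⟩
      symp m (transvection m q v) (transvection m q w) ≡⟨ symp-transvection m q v w ⟩
      symp m v w                                     ∎
      where open ≡-Reasoning

    Q0-vo : Q0 m q ≡ false → ∀ v → Q0 m (vmul m v o) xor symp m (transvection m q v) q₀ ≡ Q0 m v xor symp m v q
    Q0-vo q-singular v = begin
      Q0 m vo xor symp m (transvection m q v) q₀
        ≡⟨ cong (Q0 m vo xor_) (trans (symp-cong m {w = q₀} {w′ = q₀} (sym ∘ act-vo v) (λ _ → refl)) (g-sp vo b)) ⟩
      Q0 m vo xor symp m vo b                       ≡⟨ Q0-act vo ⟨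
      Q0 m (act vo)                                 ≡⟨ Q0-cong m (act-vo v) ⟩
      Q0 m (transvection m q v)                     ≡⟨ Q0-transvection m q q-singular v ⟩
      Q0 m v xor symp m v q                         ∎
      where
      open ≡-Reasoning
      vo = vmul m v o

  coset-representative : InRightCoset m g (M' m q₀)
  coset-representative = o , (o-symplectic , o-orthogonal) , M'q₀≡o·g
    where
    o : Mat m
    o i = proj₁ (act-surjective (M' m q₀ i))
    M'q₀≡o·g : MatEq m (M' m q₀) (mmul m o g)
    M'q₀≡o·g i j = sym (proj₂ (act-surjective (M' m q₀ i)) j)
    open InCoset M'q₀≡o·g
    o-orthogonal : ∀ v → Q0 m (vmul m v o) ≡ Q0 m v
    o-orthogonal v = ∙-cancelʳ (symp m v q₀) (Q0 m (vmul m v o)) (Q0 m v)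
      (trans (cong (Q0 m (vmul m v o) xor_) (sym (symp-transvection-center m q₀ v))) (Q0-vo Q0-q₀ v))

  coset-representative-unique : ∀ q → Q0 m q ≡ false → InRightCoset m g (M' m q) → MatEq m (M' m q) (M' m q₀)
  coset-representative-unique q q-singular (o , (_ , o-orthogonal) , M'q≡o·g) =
    M'-cong m (transvection-center-unique m λ v →
      ∙-cancelˡ (Q0 m v) (symp m (transvection m q v) q₀) (symp m v q)
        (trans (cong (_xor symp m (transvection m q v) q₀) (sym (o-orthogonal v))) (Q0-vo q-singular v)))
    where open InCoset M'q≡o·g

mainTheorem3 : (m : ℕ) (g : Mat m) → IsSp m g →
    Σ (V m) (λ q → (Q0 m q ≡ false) × InRightCoset m g (M' m q)
      × ((q' : V m) → Q0 m q' ≡ false → InRightCoset m g (M' m q') → MatEq m (M' m q') (M' m q)))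
mainTheorem3 m g g-sp = q₀ , Q0-q₀ , coset-representative , coset-representative-unique
  where open SymplecticMatrix m g g-sp
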